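{- Let $\Gamma(G)$ be a connected signed graph on $n$ vertices, let $v$ be a cut-point of $\Gamma(G)$, and let $\Gamma(G_1),\Gamma(G_2),\ldots,\Gamma(G_s)$ be all the connected components of $\Gamma(G-v)$. If there is a component, say $\Gamma(G_1)$, such that $\eta(\Gamma(G_1))=\eta(\Gamma(G_1+v))+1$, then $$\eta(\Gamma(G))=\eta(\Gamma(G-v))-1=\sum_{i=1}^{s}\eta(\Gamma(G_i))-1.$$
   Context: A signed graph $\Gamma(G)=(G,\sigma)$ consists of a simple graph $G=(V,E)$ and a map $\sigma:E\to\{+,-\}$; its adjacency matrix has $(i,j)$ entry $\sigma(v_iv_j)$ if $v_iv_j\in E$ and $0$ otherwise, and its nullity $\eta(\Gamma(G))$ is the multiplicity of the eigenvalue $0$ of this matrix. Subgraphs inherit signs. A cut-point is a vertex $v$ whose removal disconnects $G$. $G-v$ denotes $G$ with $v$ and its incident edges removed; for an induced subgraph $G_1$ and a vertex $v\notin V(G_1)$, $G_1+v$ denotes the subgraph induced by $V(G_1)\cup\{v\}$. -}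

module Defs where

open import Data.Nat using (ℕ; zero; suc)
open import Data.Fin using (Fin; zero; suc)
open import Data.Bool using (true; false)
open import Data.Vec using (Vec; []; _∷_)
open import Data.Maybe using (Maybe; just; nothing)
open import Data.Product using (Σ; _×_; ∃)
open import Data.Rational using (ℚ; 0ℚ; 1ℚ; -_; _+_; _*_)
open import Data.Fin.Subset using (Subset; _∈_; _⊆_; ∁; ⁅_⁆; _∪_)
open import Relation.Nullary using (¬_)
open import Relation.Binary.PropositionalEquality using (_≡_; _≢_)

data Sign : Set where
  plus minus : Sign

-- A signed (simple) graph on the vertex set Fin n:
-- edge u w = nothing  if uw ∉ E,  just σ(uw)  otherwise.
record SignedGraph (n : ℕ) : Set where
  field
    edge      : Fin n → Fin n → Maybe Sign
    symmetric : ∀ u w → edge u w ≡ edge w u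
    loopless  : ∀ u → edge u u ≡ nothing
open SignedGraph public

Adjacent : ∀ {n} → SignedGraph n → Fin n → Fin n → Set
Adjacent Γ u w = edge Γ u w ≢ nothing

signValue : Maybe Sign → ℚ
signValue nothing      = 0ℚ
signValue (just plus)  = 1ℚ
signValue (just minus) = - 1ℚ

adjMatrix : ∀ {n} → SignedGraph n → Fin n → Fin n → ℚ
adjMatrix Γ u w = signValue (edge Γ u w)

sumFin : ∀ {m} → (Fin m → ℚ) → ℚ
sumFin {zero}  f = 0ℚ
sumFin {suc m} f = f zero + sumFin (λ i → f (suc i))

InKernel : ∀ {m} → (Fin m → Fin m → ℚ) → (Fin m → ℚ) → Set
InKernel M x = ∀ i → sumFin (λ j → M i j * x j) ≡ 0ℚ

LinIndep : ∀ {k m} → (Fin k → Fin m → ℚ) → Set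
LinIndep {k} vs =
  (c : Fin k → ℚ) → (∀ j → sumFin (λ l → c l * vs l j) ≡ 0ℚ) → ∀ l → c l ≡ 0ℚ

Nullity : ∀ {m} → (Fin m → Fin m → ℚ) → ℕ → Set
Nullity {m} M k =
  (Σ (Fin k → Fin m → ℚ) λ vs → (∀ l → InKernel M (vs l)) × LinIndep vs)
  × ((ws : Fin (suc k) → Fin m → ℚ) → (∀ l → InKernel M (ws l)) → ¬ LinIndep ws)

card : ∀ {n} → Subset n → ℕ
card []            = 0
card (true  ∷ S)   = suc (card S)
card (false ∷ S)   = card S

enum : ∀ {n} (S : Subset n) → Fin (card S) → Fin n
enum (true  ∷ S) zero    = zero
enum (true  ∷ S) (suc k) = suc (enum S k)
enum (false ∷ S) k       = suc (enum S k)

inducedMatrix : ∀ {n} → SignedGraph n → (S : Subset n) → Fin (card S) → Fin (card S) → ℚ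
inducedMatrix Γ S i j = adjMatrix Γ (enum S i) (enum S j)

NullityG : ∀ {n} → SignedGraph n → ℕ → Set
NullityG Γ k = Nullity (adjMatrix Γ) k

NullityOn : ∀ {n} → SignedGraph n → Subset n → ℕ → Set
NullityOn Γ S k = Nullity (inducedMatrix Γ S) k

data WalkIn {n} (Γ : SignedGraph n) (S : Subset n) : Fin n → Fin n → Set where
  here : ∀ {u} → u ∈ S → WalkIn Γ S u u
  step : ∀ {u x w} → u ∈ S → Adjacent Γ u x → WalkIn Γ S x w → WalkIn Γ S u w

ConnectedOn : ∀ {n} → SignedGraph n → Subset n → Set
ConnectedOn {n} Γ S = (∃ λ u → u ∈ S) × (∀ u w → u ∈ S → w ∈ S → WalkIn Γ S u w)

Connected : ∀ {n} → SignedGraph n → Set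
Connected {n} Γ = ∀ u w → WalkIn Γ (Data.Fin.Subset.⊤) u w

minusV : ∀ {n} → Fin n → Subset n
minusV v = ∁ ⁅ v ⁆

CutPoint : ∀ {n} → SignedGraph n → Fin n → Set
CutPoint Γ v = ¬ ConnectedOn Γ (minusV v)

IsComponentOf : ∀ {n} → SignedGraph n → Subset n → Subset n → Set
IsComponentOf Γ T C =
  C ⊆ T × ConnectedOn Γ C
  × (∀ u w → u ∈ C → w ∈ T → Adjacent Γ u w → w ∈ C)

AllComponents : ∀ {n s} → SignedGraph n → Subset n → (Fin s → Subset n) → Set
AllComponents {s = s} Γ T Cs =
  (∀ i → IsComponentOf Γ T (Cs i))
  × (∀ i j → Cs i ≡ Cs j → i ≡ j)
  × (∀ C → IsComponentOf Γ T C → ∃ λ i → Cs i ≡ C)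

sumℕ : ∀ {s} → (Fin s → ℕ) → ℕ
sumℕ {zero}  f = 0
sumℕ {suc s} f = Data.Nat._+_ (f zero) (sumℕ (λ i → f (suc i)))

module Submission where

-- Write A for the adjacency matrix, T = V ∖ {v}, and K(S) for the space of vectors supported
-- on S whose product with A vanishes at the rows of S; K(S) is the null space of A[S] extended
-- by zeros, so η(Γ[S]) = dim K(S).  Dimensions are expressed by the predicates "k independent
-- vectors exist" (HasIndep) and "no k independent vectors exist" (NoIndep).
--  * No edge of G - v joins two components, so K(T) is the direct sum of the K(C_i):
--    η(G - v) = Σ η(G_i).
--  * η(G_i + v) = η(G_i) - 1 provides z ∈ K(C_i) ⊆ K(T) with (Az)_v ≠ 0.  For x in the null
--    space of A, symmetry gives x_v (Az)_v = zᵀAx = 0, so x_v = 0; hence the null space of A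
--    is the hyperplane section {x ∈ K(T) : (Ax)_v = 0}, which misses z: η(G) + 1 = η(G - v).

module LinearAlgebra where

  open import Defs using (sumFin; LinIndep; sumℕ)
  open import Data.Nat as ℕ using (ℕ; zero; suc; _≤_; _≤′_; ≤′-refl; ≤′-step; z≤n; _≤?_)
  open import Data.Nat.Properties using (≤⇒≤′; ≰⇒>; +-suc; +-cancelˡ-≤; +-monoˡ-≤; ≤-trans; m≤m+n)
  open import Data.Fin using (Fin; zero; suc; punchIn; _↑ˡ_; _↑ʳ_; splitAt)
  open import Data.Fin.Properties using (all?; ¬∀⟶∃¬; punchInᵢ≢i; suc-injective; splitAt⁻¹-↑ˡ; splitAt⁻¹-↑ʳ)
  open import Data.Fin.Subset using (Subset; _∈_; _∉_)
  open import Data.Fin.Subset.Properties using (_∈?_)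
  open import Data.Vec.Functional using (_∷_; _++_; insertAt)
  open import Data.Vec.Functional.Properties using (insertAt-lookup; insertAt-punchIn; lookup-++ˡ; lookup-++ʳ)
  open import Data.Rational using (ℚ; 0ℚ; 1ℚ; -_; _+_; _*_; 1/_; NonZero; ≢-nonZero)
  open import Data.Rational.Properties
    using ( _≟_; 1≢0; neg-injective; +-*-ring; *-zeroˡ; *-zeroʳ; *-identityʳ; *-inverseʳ; *-assoc
          ; +-identityˡ; +-identityʳ; +-assoc)
  open import Data.Rational.Solver using (module +-*-Solver)
  open +-*-Solver using (solve; con; _:+_; _:*_; :-_; _:=_)
  open import Algebra.Bundles using (Ring)
  open import Algebra.Properties.Semiring.Sum (Ring.semiring +-*-ring)
    using (sum; sum-cong-≗; sum-replicate-zero; ∑-distrib-+; ∑-comm; sum-remove; *-distribˡ-sum)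
  open import Data.Sum using (inj₁; inj₂)
  open import Data.Product using (Σ; ∃; _×_; _,_; proj₁; proj₂)
  open import Data.Unit using (⊤; tt)
  open import Data.Empty using (⊥; ⊥-elim)
  open import Relation.Nullary using (¬_; yes; no)
  open import Relation.Binary.PropositionalEquality
  open ≡-Reasoning

  cancel-nonzero : ∀ x y → y ≢ 0ℚ → x * y ≡ 0ℚ → x ≡ 0ℚ
  cancel-nonzero x y y≢0 xy≡0 = begin
      x                ≡⟨ sym (*-identityʳ x) ⟩
      x * 1ℚ           ≡⟨ cong (x *_) (sym (*-inverseʳ y)) ⟩
      x * (y * 1/ y)   ≡⟨ sym (*-assoc x y (1/ y)) ⟩
      x * y * 1/ y     ≡⟨ cong (_* 1/ y) xy≡0 ⟩
      0ℚ * 1/ y        ≡⟨ *-zeroˡ (1/ y) ⟩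
      0ℚ               ∎
    where instance y-nonzero : NonZero y
                   y-nonzero = ≢-nonZero y≢0

  *-by-zeroʳ : ∀ a {x} → x ≡ 0ℚ → a * x ≡ 0ℚ
  *-by-zeroʳ a refl = *-zeroʳ a

  *-by-zeroˡ : ∀ a {x} → x ≡ 0ℚ → x * a ≡ 0ℚ
  *-by-zeroˡ a refl = *-zeroˡ a

  sumFin≡sum : ∀ {m} (f : Fin m → ℚ) → sumFin f ≡ sum f
  sumFin≡sum {zero}  f = refl
  sumFin≡sum {suc m} f = cong (f zero +_) (sumFin≡sum (λ i → f (suc i)))

  sum-cong : ∀ {m} {f g : Fin m → ℚ} → (∀ i → f i ≡ g i) → sumFin f ≡ sumFin g
  sum-cong {f = f} {g} f≗g = begin
    sumFin f  ≡⟨ sumFin≡sum f ⟩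
    sum f     ≡⟨ sum-cong-≗ f≗g ⟩
    sum g     ≡⟨ sumFin≡sum g ⟨
    sumFin g  ∎

  sum-zero : ∀ {m} {f : Fin m → ℚ} → (∀ i → f i ≡ 0ℚ) → sumFin f ≡ 0ℚ
  sum-zero {m} {f} f≗0 = begin
    sumFin f                 ≡⟨ sumFin≡sum f ⟩
    sum f                    ≡⟨ sum-cong-≗ f≗0 ⟩
    sum (λ (_ : Fin m) → 0ℚ) ≡⟨ sum-replicate-zero m ⟩
    0ℚ                       ∎

  sum-+ : ∀ {m} (f g : Fin m → ℚ) → sumFin (λ i → f i + g i) ≡ sumFin f + sumFin g
  sum-+ f g = begin
    sumFin (λ i → f i + g i)  ≡⟨ sumFin≡sum (λ i → f i + g i) ⟩
    sum (λ i → f i + g i)     ≡⟨ ∑-distrib-+ f g ⟩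
    sum f + sum g             ≡⟨ cong₂ _+_ (sumFin≡sum f) (sumFin≡sum g) ⟨
    sumFin f + sumFin g       ∎

  sum-scale : ∀ {m} (k : ℚ) (f : Fin m → ℚ) → sumFin (λ i → k * f i) ≡ k * sumFin f
  sum-scale k f = begin
    sumFin (λ i → k * f i)  ≡⟨ sumFin≡sum (λ i → k * f i) ⟩
    sum (λ i → k * f i)     ≡⟨ *-distribˡ-sum k f ⟨
    k * sum f               ≡⟨ cong (k *_) (sumFin≡sum f) ⟨
    k * sumFin f            ∎

  sum-swap : ∀ {m k} (f : Fin m → Fin k → ℚ) →
    sumFin (λ i → sumFin (f i)) ≡ sumFin (λ j → sumFin (λ i → f i j))
  sum-swap f = begin
    sumFin (λ i → sumFin (f i))          ≡⟨ sumFin≡sum (λ i → sumFin (f i)) ⟩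
    sum (λ i → sumFin (f i))             ≡⟨ sum-cong-≗ (λ i → sumFin≡sum (f i)) ⟩
    sum (λ i → sum (f i))                ≡⟨ ∑-comm f ⟩
    sum (λ j → sum (λ i → f i j))        ≡⟨ sum-cong-≗ (λ j → sumFin≡sum (λ i → f i j)) ⟨
    sum (λ j → sumFin (λ i → f i j))     ≡⟨ sumFin≡sum (λ j → sumFin (λ i → f i j)) ⟨
    sumFin (λ j → sumFin (λ i → f i j))  ∎

  sum-punch : ∀ {k} (f : Fin (suc k) → ℚ) (p : Fin (suc k)) →
    sumFin f ≡ f p + sumFin (λ l → f (punchIn p l))
  sum-punch f p = begin
    sumFin f                           ≡⟨ sumFin≡sum f ⟩
    sum f                              ≡⟨ sum-remove f ⟩
    f p + sum (λ l → f (punchIn p l))  ≡⟨ cong (f p +_) (sumFin≡sum (λ l → f (punchIn p l))) ⟨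
    f p + sumFin (λ l → f (punchIn p l)) ∎

  sum-single : ∀ {m} (f : Fin m → ℚ) (p : Fin m) → (∀ i → i ≢ p → f i ≡ 0ℚ) → sumFin f ≡ f p
  sum-single {zero}  f () _
  sum-single {suc m} f p others≡0 = begin
    sumFin f                              ≡⟨ sum-punch f p ⟩
    f p + sumFin (λ l → f (punchIn p l))  ≡⟨ cong (f p +_) (sum-zero (λ l → others≡0 _ (punchInᵢ≢i p l))) ⟩
    f p + 0ℚ                              ≡⟨ +-identityʳ (f p) ⟩
    f p                                   ∎

  sum-split : ∀ a {b} (f : Fin (a ℕ.+ b) → ℚ) →
    sumFin f ≡ sumFin (λ i → f (i ↑ˡ b)) + sumFin (λ i → f (a ↑ʳ i))
  sum-split zero    f = sym (+-identityˡ _)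
  sum-split (suc a) f = trans (cong (f zero +_) (sum-split a (λ i → f (suc i)))) (sym (+-assoc (f zero) _ _))

  Vect : ℕ → Set
  Vect n = Fin n → ℚ

  lin : ∀ {k n} → (Fin k → ℚ) → (Fin k → Vect n) → Vect n
  lin c vs j = sumFin (λ l → c l * vs l j)

  HasIndep : ∀ {n} → (Vect n → Set) → ℕ → Set
  HasIndep {n} P k = Σ (Fin k → Vect n) λ vs → (∀ l → P (vs l)) × LinIndep vs

  NoIndep : ∀ {n} → (Vect n → Set) → ℕ → Set
  NoIndep {n} P k = (ws : Fin k → Vect n) → (∀ l → P (ws l)) → ¬ LinIndep ws

  Closed : ∀ {n} → (Vect n → Set) → Set
  Closed P = ∀ {k} (c : Fin k → ℚ) vs → (∀ l → P (vs l)) → P (lin c vs)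

  Linear : ∀ {n m} → (Vect n → Vect m) → Set
  Linear π = ∀ {k} (c : Fin k → ℚ) vs i → π (lin c vs) i ≡ lin c (λ l → π (vs l)) i

  lin-+ : ∀ {n k} (c d : Fin k → ℚ) (e : ℚ) (ps : Fin k → Vect n) x →
    lin (λ l → c l + e * d l) ps x ≡ lin c ps x + e * lin d ps x
  lin-+ c d e ps x = begin
    sumFin (λ l → (c l + e * d l) * ps l x)
      ≡⟨ sum-cong (λ l → distrib (c l) e (d l) (ps l x)) ⟩
    sumFin (λ l → c l * ps l x + e * (d l * ps l x))
      ≡⟨ sum-+ (λ l → c l * ps l x) (λ l → e * (d l * ps l x)) ⟩
    lin c ps x + sumFin (λ l → e * (d l * ps l x))
      ≡⟨ cong (lin c ps x +_) (sum-scale e (λ l → d l * ps l x)) ⟩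
    lin c ps x + e * lin d ps x ∎
    where
    distrib : ∀ c e d p → (c + e * d) * p ≡ c * p + e * (d * p)
    distrib = solve 4 (λ c e d p → (c :+ e :* d) :* p := c :* p :+ e :* (d :* p)) refl

  lin-insert0 : ∀ {n k} (p : Fin (suc k)) (c : Fin k → ℚ) (ps : Fin (suc k) → Vect n) x →
    lin (insertAt c p 0ℚ) ps x ≡ lin c (λ l → ps (punchIn p l)) x
  lin-insert0 p c ps x = begin
    lin (insertAt c p 0ℚ) ps x
      ≡⟨ sum-punch (λ l → insertAt c p 0ℚ l * ps l x) p ⟩
    insertAt c p 0ℚ p * ps p x + sumFin (λ l → insertAt c p 0ℚ (punchIn p l) * ps (punchIn p l) x)
      ≡⟨ cong₂ _+_ (*-by-zeroˡ (ps p x) (insertAt-lookup c p 0ℚ))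
                   (sum-cong (λ l → cong (_* ps (punchIn p l) x) (insertAt-punchIn c p 0ℚ l))) ⟩
    0ℚ + lin c (λ l → ps (punchIn p l)) x
      ≡⟨ +-identityˡ _ ⟩
    lin c (λ l → ps (punchIn p l)) x ∎

  indep-tail : ∀ {k n} {ws : Fin (suc k) → Vect n} → LinIndep ws → LinIndep (λ l → ws (suc l))
  indep-tail {ws = ws} ind c c·ws≡0 l = ind (0ℚ ∷ c) rel (suc l)
    where
    rel : ∀ x → 0ℚ * ws zero x + lin c (λ l → ws (suc l)) x ≡ 0ℚ
    rel x = begin
      0ℚ * ws zero x + lin c (λ l → ws (suc l)) x  ≡⟨ cong (_+ lin c (λ l → ws (suc l)) x) (*-zeroˡ (ws zero x)) ⟩
      0ℚ + lin c (λ l → ws (suc l)) x              ≡⟨ +-identityˡ _ ⟩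
      lin c (λ l → ws (suc l)) x                   ≡⟨ c·ws≡0 x ⟩
      0ℚ                                           ∎

  noIndep-suc : ∀ {n k} {P : Vect n → Set} → NoIndep P k → NoIndep P (suc k)
  noIndep-suc {P = P} none ws ws∈P ind = none (λ l → ws (suc l)) (λ l → ws∈P (suc l)) (indep-tail {ws = ws} ind)

  noIndep-mono : ∀ {n k m} {P : Vect n → Set} → NoIndep P k → k ≤ m → NoIndep P m
  noIndep-mono {k = k} {P = P} none k≤m = go (≤⇒≤′ k≤m)
    where
    go : ∀ {m} → k ≤′ m → NoIndep P m
    go ≤′-refl       = none
    go (≤′-step k≤m) = noIndep-suc {P = P} (go k≤m)

  hasIndep-⊆ : ∀ {n k} {P P′ : Vect n → Set} → (∀ x → P x → P′ x) → HasIndep P k → HasIndep P′ k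
  hasIndep-⊆ P⊆P′ (vs , vs∈P , ind) = vs , (λ l → P⊆P′ (vs l) (vs∈P l)) , ind

  noIndep-⊆ : ∀ {n k} {P P′ : Vect n → Set} → (∀ x → P x → P′ x) → NoIndep P′ k → NoIndep P k
  noIndep-⊆ P⊆P′ none ws ws∈P = none ws (λ l → P⊆P′ (ws l) (ws∈P l))

  dim-≤ : ∀ {n a b} {P : Vect n → Set} → HasIndep P a → NoIndep P (suc b) → a ≤ b
  dim-≤ {a = a} {b} {P} (vs , vs∈P , ind) none with a ≤? b
  ... | yes a≤b = a≤b
  ... | no  a≰b = ⊥-elim (noIndep-mono {P = P} none (≰⇒> a≰b) vs vs∈P ind)

  dependent : ∀ {k n} (ws : Fin k → Vect n) → ¬ LinIndep ws →
    ¬ ¬ (∃ λ (c : Fin k → ℚ) → ∃ λ p → c p ≢ 0ℚ × (∀ x → lin c ws x ≡ 0ℚ))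
  dependent {k} ws dep no-relation = dep indep
    where
    indep : LinIndep ws
    indep c c·ws≡0 with all? (λ l → c l ≟ 0ℚ)
    ... | yes c≡0 = c≡0
    ... | no  c≢0 with ¬∀⟶∃¬ k (λ l → c l ≡ 0ℚ) (λ l → c l ≟ 0ℚ) c≢0
    ...   | p , cp≢0 = ⊥-elim (no-relation (c , p , cp≢0 , c·ws≡0))

  JointlyIndep : ∀ {n k j} → (Fin k → Vect n) → (Fin j → Vect n) → Set
  JointlyIndep ps us =
    ∀ c d → (∀ x → lin c ps x + lin d us x ≡ 0ℚ) → (∀ l → c l ≡ 0ℚ) × (∀ l → d l ≡ 0ℚ)

  joint⇒indepʳ : ∀ {n k j} {ps : Fin k → Vect n} {us : Fin j → Vect n} → JointlyIndep ps us → LinIndep us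
  joint⇒indepʳ {ps = ps} {us} ind d d·us≡0 = proj₂ (ind (λ _ → 0ℚ) d rel)
    where
    rel : ∀ x → lin (λ _ → 0ℚ) ps x + lin d us x ≡ 0ℚ
    rel x = begin
      lin (λ _ → 0ℚ) ps x + lin d us x  ≡⟨ cong (_+ lin d us x) (sum-zero (λ l → *-zeroˡ (ps l x))) ⟩
      0ℚ + lin d us x                   ≡⟨ +-identityˡ _ ⟩
      lin d us x                        ≡⟨ d·us≡0 x ⟩
      0ℚ                                ∎

  exchange-step : ∀ {n k j} (ps : Fin (suc k) → Vect n) (us : Fin j → Vect n) (c : Fin (suc k) → ℚ) p →
    c p ≢ 0ℚ → JointlyIndep ps us → JointlyIndep (λ l → ps (punchIn p l)) (lin c ps ∷ us)
  exchange-step {n} {k} {j} ps us c p cp≢0 ind c′ d′ rel′ = c′≡0 , d′≡0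
    where
    u : Vect n
    u = lin c ps
    -- the relation (c′, d′) rewritten in terms of the original families
    C : Fin (suc k) → ℚ
    C l = insertAt c′ p 0ℚ l + d′ zero * c l
    D : Fin j → ℚ
    D l = d′ (suc l)
    rel : ∀ x → lin C ps x + lin D us x ≡ 0ℚ
    rel x = begin
      lin C ps x + lin D us x
        ≡⟨ cong (_+ lin D us x) (lin-+ (insertAt c′ p 0ℚ) c (d′ zero) ps x) ⟩
      (lin (insertAt c′ p 0ℚ) ps x + d′ zero * u x) + lin D us x
        ≡⟨ cong (λ t → (t + d′ zero * u x) + lin D us x) (lin-insert0 p c′ ps x) ⟩
      (lin c′ (λ l → ps (punchIn p l)) x + d′ zero * u x) + lin D us x
        ≡⟨ +-assoc (lin c′ (λ l → ps (punchIn p l)) x) (d′ zero * u x) (lin D us x) ⟩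
      lin c′ (λ l → ps (punchIn p l)) x + lin d′ (u ∷ us) x
        ≡⟨ rel′ x ⟩
      0ℚ ∎
    C≡0 : ∀ l → C l ≡ 0ℚ
    C≡0 = proj₁ (ind C D rel)
    d′₀≡0 : d′ zero ≡ 0ℚ
    d′₀≡0 = cancel-nonzero (d′ zero) (c p) cp≢0 (begin
      d′ zero * c p                          ≡⟨ +-identityˡ _ ⟨
      0ℚ + d′ zero * c p                     ≡⟨ cong (_+ d′ zero * c p) (insertAt-lookup c′ p 0ℚ) ⟨
      insertAt c′ p 0ℚ p + d′ zero * c p     ≡⟨ C≡0 p ⟩
      0ℚ                                     ∎)
    c′≡0 : ∀ l → c′ l ≡ 0ℚ
    c′≡0 l = begin
      c′ l
        ≡⟨ +-identityʳ (c′ l) ⟨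
      c′ l + 0ℚ
        ≡⟨ cong (c′ l +_) (*-zeroˡ (c (punchIn p l))) ⟨
      c′ l + 0ℚ * c (punchIn p l)
        ≡⟨ cong₂ (λ s t → s + t * c (punchIn p l)) (insertAt-punchIn c′ p 0ℚ l) d′₀≡0 ⟨
      insertAt c′ p 0ℚ (punchIn p l) + d′ zero * c (punchIn p l)
        ≡⟨ C≡0 (punchIn p l) ⟩
      0ℚ ∎
    d′≡0 : ∀ l → d′ l ≡ 0ℚ
    d′≡0 zero    = d′₀≡0
    d′≡0 (suc l) = proj₂ (ind C D rel) l

  -- Subadditivity of dimension along a linear map π restricted to a subspace P:
  -- dim P ≤ dim π(P) + dim (P ∩ ker π), with both bounds given by enclosing spaces Q and R.
  module Subadditivity {n m} {P R : Vect n → Set} {Q : Vect m → Set} {π : Vect n → Vect m} {a b : ℕ}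
    (P-closed : Closed P) (π-linear : Linear π)
    (Q-small : NoIndep Q (suc a)) (R-small : NoIndep R (suc b))
    (image⊆Q : ∀ x → P x → Q (π x)) (kernel⊆R : ∀ x → P x → (∀ i → π x i ≡ 0ℚ) → R x) where

    -- While |ps| > a the images π ps are dependent, and the exchange step moves one vector
    -- of ps into ker π; once |ps| ≤ a, the us alone are more than b independent vectors of R.
    exchange : ∀ k j (ps : Fin k → Vect n) (us : Fin j → Vect n) →
      (∀ l → P (ps l)) → (∀ l → P (us l)) → (∀ l i → π (us l) i ≡ 0ℚ) →
      JointlyIndep ps us → suc (a ℕ.+ b) ≤ k ℕ.+ j → ⊥
    exchange k j ps us ps∈P us∈P πus≡0 ind size with k ≤? a
    ... | yes k≤a = noIndep-mono {P = R} R-small b<j us (λ l → kernel⊆R (us l) (us∈P l) (πus≡0 l))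
                      (joint⇒indepʳ {ps = ps} ind)
      where
      b<j : suc b ≤ j
      b<j = +-cancelˡ-≤ a (suc b) j
              (≤-trans (subst (_≤ k ℕ.+ j) (sym (+-suc a b)) size) (+-monoˡ-≤ j k≤a))
    exchange zero    j ps us ps∈P us∈P πus≡0 ind size | no k≰a = k≰a z≤n
    exchange (suc k) j ps us ps∈P us∈P πus≡0 ind size | no k≰a =
      dependent (λ l → π (ps l)) images-dependent replace
      where
      images-dependent : ¬ LinIndep (λ l → π (ps l))
      images-dependent = noIndep-mono {P = Q} Q-small (≰⇒> k≰a) _ (λ l → image⊆Q (ps l) (ps∈P l))
      replace : ¬ (∃ λ (c : Fin (suc k) → ℚ) → ∃ λ p → c p ≢ 0ℚ × (∀ i → lin c (λ l → π (ps l)) i ≡ 0ℚ))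
      replace (c , p , cp≢0 , πu≡0) =
        exchange k (suc j) (λ l → ps (punchIn p l)) (lin c ps ∷ us)
          (λ l → ps∈P (punchIn p l))
          (λ { zero → P-closed c ps ps∈P ; (suc l) → us∈P l })
          (λ { zero i → trans (π-linear c ps i) (πu≡0 i) ; (suc l) → πus≡0 l })
          (exchange-step ps us c p cp≢0 ind)
          (subst (suc (a ℕ.+ b) ≤_) (sym (+-suc k j)) size)

    dim-subadditive : NoIndep P (suc (a ℕ.+ b))
    dim-subadditive ws ws∈P ind =
      exchange (suc (a ℕ.+ b)) 0 ws (λ ()) ws∈P (λ ()) (λ ()) joint (m≤m+n _ 0)
      where
      joint : JointlyIndep ws (λ ())
      joint c d rel = ind c (λ x → trans (sym (+-identityʳ _)) (rel x)) , λ ()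

  dot : ∀ {n} → Vect n → Vect n → ℚ
  dot a x = sumFin (λ j → a j * x j)

  dot-cong : ∀ {n} (a : Vect n) {x y : Vect n} → (∀ j → x j ≡ y j) → dot a x ≡ dot a y
  dot-cong a x≗y = sum-cong (λ j → cong (a j *_) (x≗y j))

  dot-zero : ∀ {n} (a x : Vect n) → (∀ j → x j ≡ 0ℚ) → dot a x ≡ 0ℚ
  dot-zero a x x≗0 = sum-zero (λ j → *-by-zeroʳ (a j) (x≗0 j))

  dot-lin : ∀ {n k} (a : Vect n) (c : Fin k → ℚ) (vs : Fin k → Vect n) →
    dot a (lin c vs) ≡ sumFin (λ l → c l * dot a (vs l))
  dot-lin a c vs = begin
    sumFin (λ j → a j * sumFin (λ l → c l * vs l j))
      ≡⟨ sum-cong (λ j → sym (sum-scale (a j) (λ l → c l * vs l j))) ⟩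
    sumFin (λ j → sumFin (λ l → a j * (c l * vs l j)))
      ≡⟨ sum-swap (λ j l → a j * (c l * vs l j)) ⟩
    sumFin (λ l → sumFin (λ j → a j * (c l * vs l j)))
      ≡⟨ sum-cong (λ l → trans (sum-cong (λ j → swap-factors (a j) (c l) (vs l j)))
                               (sum-scale (c l) (λ j → a j * vs l j))) ⟩
    sumFin (λ l → c l * dot a (vs l)) ∎
    where
    swap-factors : ∀ a c v → a * (c * v) ≡ c * (a * v)
    swap-factors = solve 3 (λ a c v → a :* (c :* v) := c :* (a :* v)) refl

  symmetric-pairing : ∀ {n} (A : Fin n → Fin n → ℚ) → (∀ i j → A i j ≡ A j i) → (x z : Vect n) →
    sumFin (λ j → x j * dot (A j) z) ≡ sumFin (λ i → z i * dot (A i) x)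
  symmetric-pairing A A-sym x z = begin
    sumFin (λ j → x j * dot (A j) z)
      ≡⟨ sum-cong (λ j → sym (sum-scale (x j) (λ i → A j i * z i))) ⟩
    sumFin (λ j → sumFin (λ i → x j * (A j i * z i)))
      ≡⟨ sum-swap (λ j i → x j * (A j i * z i)) ⟩
    sumFin (λ i → sumFin (λ j → x j * (A j i * z i)))
      ≡⟨ sum-cong (λ i → trans (sum-cong (λ j → transpose (x j) (A j i) (A i j) (z i) (A-sym j i)))
                               (sum-scale (z i) (λ j → A i j * x j))) ⟩
    sumFin (λ i → z i * dot (A i) x) ∎
    where
    transpose : ∀ x a a′ z → a ≡ a′ → x * (a * z) ≡ z * (a′ * x)
    transpose x a a′ z refl = solve 3 (λ x a z → x :* (a :* z) := z :* (a :* x)) refl x a z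

  -- ℚ¹ is one-dimensional: any two of its vectors are dependent.  With α, β the two
  -- scalars, (β, -α) is a relation, forcing α = 0, and then (1, 0) is a nontrivial relation.
  line-dim : NoIndep {1} (λ _ → ⊤) 2
  line-dim ws _ ind = 1≢0 (ind (1ℚ ∷ λ _ → 0ℚ) unit-relation zero)
    where
    α β : ℚ
    α = ws zero zero
    β = ws (suc zero) zero
    cross-relation : ∀ x → β * ws zero x + ((- α) * ws (suc zero) x + 0ℚ) ≡ 0ℚ
    cross-relation zero = solve 2 (λ α β → β :* α :+ ((:- α) :* β :+ con 0ℚ) := con 0ℚ) refl α β
    α≡0 : α ≡ 0ℚ
    α≡0 = neg-injective (ind (β ∷ λ _ → - α) cross-relation (suc zero))
    unit-relation : ∀ x → 1ℚ * ws zero x + (0ℚ * ws (suc zero) x + 0ℚ) ≡ 0ℚ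
    unit-relation zero = cong₂ (λ s t → 1ℚ * s + (t + 0ℚ)) α≡0 (*-zeroˡ β)

  dot-linear : ∀ {n} (a : Vect n) → Linear {n} {1} (λ x _ → dot a x)
  dot-linear a c vs _ = dot-lin a c vs

  Hyperplane : ∀ {n} → (Vect n → Set) → Vect n → Vect n → Set
  Hyperplane P a x = P x × dot a x ≡ 0ℚ

  hyperplane-upper : ∀ {n k} {P : Vect n → Set} (a : Vect n) → Closed P →
    NoIndep (Hyperplane P a) (suc k) → NoIndep P (suc (suc k))
  hyperplane-upper {P = P} a P-closed section-small =
    Subadditivity.dim-subadditive {P = P} {R = Hyperplane P a} {Q = λ _ → ⊤} {π = λ x _ → dot a x} {a = 1}
      P-closed (dot-linear a) line-dim section-small (λ _ _ → tt) (λ x x∈P ax≡0 → x∈P , ax≡0 zero)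

  hyperplane-lower : ∀ {n k} {P : Vect n → Set} (a z : Vect n) → P z → dot a z ≢ 0ℚ →
    HasIndep (Hyperplane P a) k → HasIndep P (suc k)
  hyperplane-lower {P = P} a z z∈P az≢0 (xs , xs∈H , xs-indep) = z ∷ xs , members , indep
    where
    members : ∀ l → P ((z ∷ xs) l)
    members zero    = z∈P
    members (suc l) = proj₁ (xs∈H l)
    indep : LinIndep (z ∷ xs)
    indep k rel = k≡0
      where
      -- applying a · _ to the relation leaves only the z-term
      k₀≡0 : k zero ≡ 0ℚ
      k₀≡0 = cancel-nonzero (k zero) (dot a z) az≢0 (begin
        k zero * dot a z
          ≡⟨ +-identityʳ _ ⟨
        k zero * dot a z + 0ℚ
          ≡⟨ cong (k zero * dot a z +_) (sum-zero (λ l → *-by-zeroʳ (k (suc l)) (proj₂ (xs∈H l)))) ⟨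
        sumFin (λ l → k l * dot a ((z ∷ xs) l))
          ≡⟨ dot-lin a k (z ∷ xs) ⟨
        dot a (lin k (z ∷ xs))
          ≡⟨ dot-zero a (lin k (z ∷ xs)) rel ⟩
        0ℚ ∎)
      rest-relation : ∀ j → lin (λ l → k (suc l)) xs j ≡ 0ℚ
      rest-relation j = begin
        lin (λ l → k (suc l)) xs j                   ≡⟨ +-identityˡ _ ⟨
        0ℚ + lin (λ l → k (suc l)) xs j              ≡⟨ cong (_+ lin (λ l → k (suc l)) xs j) (*-by-zeroˡ (z j) k₀≡0) ⟨
        k zero * z j + lin (λ l → k (suc l)) xs j    ≡⟨ rel j ⟩
        0ℚ                                           ∎
      k≡0 : ∀ l → k l ≡ 0ℚ
      k≡0 zero    = k₀≡0
      k≡0 (suc l) = xs-indep (λ l → k (suc l)) rest-relation l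

  off-hyperplane : ∀ {n k} {P : Vect n → Set} (a : Vect n) → HasIndep P k → NoIndep (Hyperplane P a) k →
    ∃ λ z → P z × dot a z ≢ 0ℚ
  off-hyperplane {k = k} a (es , es∈P , es-indep) section-small with all? (λ l → dot a (es l) ≟ 0ℚ)
  ... | yes all-in = ⊥-elim (section-small es (λ l → es∈P l , all-in l) es-indep)
  ... | no  ¬all-in with ¬∀⟶∃¬ k (λ l → dot a (es l) ≡ 0ℚ) (λ l → dot a (es l) ≟ 0ℚ) ¬all-in
  ...   | l , ael≢0 = es l , es∈P l , ael≢0

  mask : ∀ {n} → Subset n → Vect n → Vect n
  mask S x j with j ∈? S
  ... | yes _ = x j
  ... | no  _ = 0ℚ

  mask-in : ∀ {n} {S : Subset n} (x : Vect n) {j} → j ∈ S → mask S x j ≡ x j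
  mask-in {S = S} x {j} j∈S with j ∈? S
  ... | yes _   = refl
  ... | no  j∉S = ⊥-elim (j∉S j∈S)

  mask-out : ∀ {n} {S : Subset n} (x : Vect n) {j} → j ∉ S → mask S x j ≡ 0ℚ
  mask-out {S = S} x {j} j∉S with j ∈? S
  ... | yes j∈S = ⊥-elim (j∉S j∈S)
  ... | no  _   = refl

  mask-linear : ∀ {n} (S : Subset n) → Linear (mask S)
  mask-linear S c vs j with j ∈? S
  ... | yes _ = refl
  ... | no  _ = sym (sum-zero (λ l → *-zeroʳ (c l)))

  VanishingOn : ∀ {n} → Subset n → (Vect n → Set) → Vect n → Set
  VanishingOn S P x = P x × (∀ j → j ∈ S → x j ≡ 0ℚ)

  vanishingOn-closed : ∀ {n} (S : Subset n) {P : Vect n → Set} → Closed P → Closed (VanishingOn S P)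
  vanishingOn-closed S P-closed c vs vs∈ =
    P-closed c vs (λ l → proj₁ (vs∈ l)) ,
    λ j j∈S → sum-zero (λ l → *-by-zeroʳ (c l) (proj₂ (vs∈ l) j j∈S))

  direct-sum-upper : ∀ {n} s (S : Fin s → Subset n) (Q : Fin s → Vect n → Set) (ds : Fin s → ℕ)
    (P : Vect n → Set) → Closed P → (∀ i x → P x → Q i (mask (S i) x)) →
    (∀ x → P x → ∀ j → (∀ i → j ∉ S i) → x j ≡ 0ℚ) →
    (∀ i → NoIndep (Q i) (suc (ds i))) → NoIndep P (suc (sumℕ ds))
  direct-sum-upper zero S Q ds P P-closed restrict vanish Q-small ws ws∈P ind =
    1≢0 (ind (λ _ → 1ℚ) (λ j → cong (λ t → 1ℚ * t + 0ℚ) (vanish (ws zero) (ws∈P zero) j (λ ()))) zero)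
  direct-sum-upper {n} (suc s) S Q ds P P-closed restrict vanish Q-small =
    Subadditivity.dim-subadditive {P = P} {R = P₀} {Q = Q zero} {π = mask (S zero)}
      P-closed (mask-linear (S zero)) (Q-small zero) rest-small (restrict zero)
      (λ x x∈P masked≡0 → x∈P , λ j j∈S → trans (sym (mask-in x j∈S)) (masked≡0 j))
    where
    P₀ : Vect n → Set
    P₀ = VanishingOn (S zero) P
    vanish₀ : ∀ x → P₀ x → ∀ j → (∀ i → j ∉ S (suc i)) → x j ≡ 0ℚ
    vanish₀ x (x∈P , x≡0-on-S₀) j j∉rest with j ∈? S zero
    ... | yes j∈S₀ = x≡0-on-S₀ j j∈S₀
    ... | no  j∉S₀ = vanish x x∈P j (λ { zero → j∉S₀ ; (suc i) → j∉rest i })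
    rest-small : NoIndep P₀ (suc (sumℕ (λ i → ds (suc i))))
    rest-small = direct-sum-upper s (λ i → S (suc i)) (λ i → Q (suc i)) (λ i → ds (suc i)) P₀
      (vanishingOn-closed (S zero) {P} P-closed) (λ i x x∈P₀ → restrict (suc i) x (proj₁ x∈P₀))
      vanish₀ (λ i → Q-small (suc i))

  lin-++ : ∀ {n a b} (c : Fin (a ℕ.+ b) → ℚ) (F : Fin a → Vect n) (G : Fin b → Vect n) x →
    lin c (F ++ G) x ≡ lin (λ k → c (k ↑ˡ b)) F x + lin (λ k → c (a ↑ʳ k)) G x
  lin-++ {a = a} {b} c F G x = trans (sum-split a (λ l → c l * (F ++ G) l x))
    (cong₂ _+_ (sum-cong (λ k → cong (λ v → c (k ↑ˡ b) * v x) (lookup-++ˡ F G k)))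
               (sum-cong (λ k → cong (λ v → c (a ↑ʳ k) * v x) (lookup-++ʳ F G k))))

  vanish-++ : ∀ {a b} (c : Fin (a ℕ.+ b) → ℚ) →
    (∀ k → c (k ↑ˡ b) ≡ 0ℚ) → (∀ k → c (a ↑ʳ k) ≡ 0ℚ) → ∀ i → c i ≡ 0ℚ
  vanish-++ {a} c left right i with splitAt a i in eq
  ... | inj₁ k = subst (λ i → c i ≡ 0ℚ) (splitAt⁻¹-↑ˡ eq) (left k)
  ... | inj₂ k = subst (λ i → c i ≡ 0ℚ) (splitAt⁻¹-↑ʳ eq) (right k)

  -- Independent families F, supported in S, and G, vanishing on S, concatenate to an
  -- independent family: on S a relation only sees F, and then only G remains.
  ++-indep : ∀ {n a b} (S : Subset n) (F : Fin a → Vect n) (G : Fin b → Vect n) → LinIndep F → LinIndep G →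
    (∀ k j → j ∉ S → F k j ≡ 0ℚ) → (∀ k j → j ∈ S → G k j ≡ 0ℚ) →
    LinIndep (F ++ G)
  ++-indep {a = a} {b} S F G F-indep G-indep F-supported G-vanishes c rel =
    vanish-++ c (F-indep cF F-part) (G-indep cG G-part)
    where
    cF : Fin a → ℚ
    cF k = c (k ↑ˡ b)
    cG : Fin b → ℚ
    cG k = c (a ↑ʳ k)
    F-part : ∀ j → lin cF F j ≡ 0ℚ
    F-part j with j ∈? S
    ... | yes j∈S = begin
      lin cF F j                 ≡⟨ +-identityʳ _ ⟨
      lin cF F j + 0ℚ            ≡⟨ cong (lin cF F j +_) (dot-zero cG (λ k → G k j) (λ k → G-vanishes k j j∈S)) ⟨
      lin cF F j + lin cG G j    ≡⟨ lin-++ c F G j ⟨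
      lin c (F ++ G) j           ≡⟨ rel j ⟩
      0ℚ                         ∎
    ... | no j∉S = dot-zero cF (λ k → F k j) (λ k → F-supported k j j∉S)
    G-part : ∀ j → lin cG G j ≡ 0ℚ
    G-part j = begin
      lin cG G j                 ≡⟨ +-identityˡ _ ⟨
      0ℚ + lin cG G j            ≡⟨ cong (_+ lin cG G j) (F-part j) ⟨
      lin cF F j + lin cG G j    ≡⟨ lin-++ c F G j ⟨
      lin c (F ++ G) j           ≡⟨ rel j ⟩
      0ℚ                         ∎

  direct-sum-lower : ∀ {n} s (S : Fin s → Subset n) (Q : Fin s → Vect n → Set) (ds : Fin s → ℕ)
    (P : Vect n → Set) → (∀ i x → Q i x → P x) → (∀ i x → Q i x → ∀ j → j ∉ S i → x j ≡ 0ℚ) →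
    (∀ i i′ j → i ≢ i′ → j ∈ S i → j ∉ S i′) →
    (∀ i → HasIndep (Q i) (ds i)) → HasIndep P (sumℕ ds)
  direct-sum-lower zero    S Q ds P Q⊆P supported disjoint Q-large = (λ ()) , (λ ()) , (λ _ _ ())
  direct-sum-lower {n} (suc s) S Q ds P Q⊆P supported disjoint Q-large =
    F ++ G , members ,
    ++-indep (S zero) F G F-indep G-indep (λ k → supported zero (F k) (F∈Q k)) (λ k → proj₂ (G∈P₀ k))
    where
    P₀ : Vect n → Set
    P₀ = VanishingOn (S zero) P
    F : Fin (ds zero) → Vect n
    F = proj₁ (Q-large zero)
    F∈Q : ∀ l → Q zero (F l)
    F∈Q = proj₁ (proj₂ (Q-large zero))
    F-indep : LinIndep F
    F-indep = proj₂ (proj₂ (Q-large zero))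
    rest : HasIndep P₀ (sumℕ (λ i → ds (suc i)))
    rest = direct-sum-lower s (λ i → S (suc i)) (λ i → Q (suc i)) (λ i → ds (suc i)) P₀
      (λ i x x∈Q → Q⊆P (suc i) x x∈Q ,
                   λ j j∈S₀ → supported (suc i) x x∈Q j (disjoint zero (suc i) j (λ ()) j∈S₀))
      (λ i → supported (suc i))
      (λ i i′ j i≢i′ → disjoint (suc i) (suc i′) j (λ e → i≢i′ (suc-injective e)))
      (λ i → Q-large (suc i))
    G : Fin (sumℕ (λ i → ds (suc i))) → Vect n
    G = proj₁ rest
    G∈P₀ : ∀ l → P₀ (G l)
    G∈P₀ = proj₁ (proj₂ rest)
    G-indep : LinIndep G
    G-indep = proj₂ (proj₂ rest)
    members : ∀ l → P ((F ++ G) l)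
    members l with splitAt (ds zero) l
    ... | inj₁ k = Q⊆P zero (F k) (F∈Q k)
    ... | inj₂ k = proj₁ (G∈P₀ k)

module SignedGraphNullity where

  open import Defs
  open LinearAlgebra
  open import Data.Nat using (ℕ; zero; suc)
  open import Data.Nat.Properties using (≤-antisym)
  open import Data.Fin using (Fin; zero; suc)
  open import Data.Fin.Properties using () renaming (_≟_ to _≟ᶠ_)
  open import Data.Fin.Subset using (Subset; _∈_; _∉_; _⊆_; ⁅_⁆; _∪_)
  open import Data.Fin.Subset.Properties
    using (_∈?_; ⊆-antisym; x∈∁p⇒x∉p; x∉p⇒x∈∁p; x≢y⇒x∉⁅y⁆; x∈⁅x⁆; x∈⁅y⁆⇒x≡y; p⊆p∪q; x∈p∪q⁻)
  open import Data.Bool using (true; false)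
  open import Data.Vec using ([]; _∷_; here; there; tabulate)
  open import Data.Vec.Properties using (lookup∘tabulate; lookup⇒[]=; []=⇒lookup)
  open import Data.Maybe using (just; nothing)
  open import Data.Rational using (ℚ; 0ℚ; _+_; _*_)
  open import Data.Rational.Properties using (_≟_; *-zeroʳ; +-identityˡ)
  open import Data.Sum using (_⊎_; inj₁; inj₂)
  open import Data.Product using (∃; _×_; _,_; proj₁; proj₂)
  open import Data.Empty using (⊥-elim)
  open import Relation.Nullary using (¬_; Dec; yes; no; does)
  open import Relation.Nullary.Decidable using (¬¬-excluded-middle)
  open import Relation.Binary.PropositionalEquality
  open ≡-Reasoning

  -- K_A(S): vectors supported on S whose product with A vanishes at every row of S.
  -- It is the null space of the principal submatrix A[S], extended by zeros.
  SupportedKernel : ∀ {n} → (Fin n → Fin n → ℚ) → Subset n → Vect n → Set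
  SupportedKernel A S x = (∀ j → j ∉ S → x j ≡ 0ℚ) × (∀ i → i ∈ S → dot (A i) x ≡ 0ℚ)

  supportedKernel-closed : ∀ {n} (A : Fin n → Fin n → ℚ) S → Closed (SupportedKernel A S)
  supportedKernel-closed A S c vs vs∈K =
    (λ j j∉S → sum-zero (λ l → *-by-zeroʳ (c l) (proj₁ (vs∈K l) j j∉S))) ,
    (λ i i∈S → trans (dot-lin (A i) c vs) (sum-zero (λ l → *-by-zeroʳ (c l) (proj₂ (vs∈K l) i i∈S))))

  spread : ∀ {n} (S : Subset n) → Vect (card S) → Vect n
  spread (true  ∷ S) y zero    = y zero
  spread (true  ∷ S) y (suc j) = spread S (λ k → y (suc k)) j
  spread (false ∷ S) y zero    = 0ℚ
  spread (false ∷ S) y (suc j) = spread S y j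

  spread-enum : ∀ {n} (S : Subset n) y k → spread S y (enum S k) ≡ y k
  spread-enum (true  ∷ S) y zero    = refl
  spread-enum (true  ∷ S) y (suc k) = spread-enum S (λ k → y (suc k)) k
  spread-enum (false ∷ S) y k       = spread-enum S y k

  spread-outside : ∀ {n} (S : Subset n) y j → j ∉ S → spread S y j ≡ 0ℚ
  spread-outside (true  ∷ S) y zero    j∉S = ⊥-elim (j∉S here)
  spread-outside (true  ∷ S) y (suc j) j∉S = spread-outside S _ j (λ j∈S → j∉S (there j∈S))
  spread-outside (false ∷ S) y zero    j∉S = refl
  spread-outside (false ∷ S) y (suc j) j∉S = spread-outside S y j (λ j∈S → j∉S (there j∈S))

  spread-restrict : ∀ {n} (S : Subset n) (x : Vect n) → (∀ j → j ∉ S → x j ≡ 0ℚ) →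
    ∀ j → spread S (λ k → x (enum S k)) j ≡ x j
  spread-restrict (true  ∷ S) x x-off zero    = refl
  spread-restrict (true  ∷ S) x x-off (suc j) =
    spread-restrict S (λ j → x (suc j)) (λ j j∉S → x-off (suc j) λ { (there j∈S) → j∉S j∈S }) j
  spread-restrict (false ∷ S) x x-off zero    = sym (x-off zero λ ())
  spread-restrict (false ∷ S) x x-off (suc j) =
    spread-restrict S (λ j → x (suc j)) (λ j j∉S → x-off (suc j) λ { (there j∈S) → j∉S j∈S }) j

  dot-spread : ∀ {n} (S : Subset n) (g : Vect n) y → dot g (spread S y) ≡ dot (λ k → g (enum S k)) y
  dot-spread []          g y = refl
  dot-spread (true  ∷ S) g y = cong (g zero * y zero +_) (dot-spread S (λ j → g (suc j)) (λ k → y (suc k)))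
  dot-spread (false ∷ S) g y = begin
    g zero * 0ℚ + dot (λ j → g (suc j)) (spread S y)  ≡⟨ cong (_+ dot (λ j → g (suc j)) (spread S y)) (*-zeroʳ (g zero)) ⟩
    0ℚ + dot (λ j → g (suc j)) (spread S y)           ≡⟨ +-identityˡ _ ⟩
    dot (λ j → g (suc j)) (spread S y)                ≡⟨ dot-spread S (λ j → g (suc j)) y ⟩
    dot (λ k → g (suc (enum S k))) y                  ∎

  enum-∈ : ∀ {n} (S : Subset n) k → enum S k ∈ S
  enum-∈ (true  ∷ S) zero    = here
  enum-∈ (true  ∷ S) (suc k) = there (enum-∈ S k)
  enum-∈ (false ∷ S) k       = there (enum-∈ S k)

  enum-onto : ∀ {n} (S : Subset n) j → j ∈ S → ∃ λ k → enum S k ≡ j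
  enum-onto (true  ∷ S) zero    here        = zero , refl
  enum-onto (true  ∷ S) (suc j) (there j∈S) with enum-onto S j j∈S
  ... | k , refl = suc k , refl
  enum-onto (false ∷ S) (suc j) (there j∈S) with enum-onto S j j∈S
  ... | k , refl = k , refl

  kernel-spread : ∀ {n} (A : Fin n → Fin n → ℚ) S k →
    HasIndep (InKernel (λ i j → A (enum S i) (enum S j))) k → HasIndep (SupportedKernel A S) k
  kernel-spread A S k (ys , ys∈ker , ys-indep) =
    (λ l → spread S (ys l)) , (λ l → spread-outside S (ys l) , rows l) , indep
    where
    rows : ∀ l i → i ∈ S → dot (A i) (spread S (ys l)) ≡ 0ℚ
    rows l i i∈S with enum-onto S i i∈S
    ... | r , refl = trans (dot-spread S (A (enum S r)) (ys l)) (ys∈ker l r)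
    indep : LinIndep (λ l → spread S (ys l))
    indep c rel = ys-indep c λ k →
      trans (sum-cong (λ l → cong (c l *_) (sym (spread-enum S (ys l) k)))) (rel (enum S k))

  kernel-restrict : ∀ {n} (A : Fin n → Fin n → ℚ) S k →
    NoIndep (InKernel (λ i j → A (enum S i) (enum S j))) k → NoIndep (SupportedKernel A S) k
  kernel-restrict A S k small ws ws∈K ws-indep = small (λ l r → ws l (enum S r)) restricted∈ker indep
    where
    restricted∈ker : ∀ l r → dot (λ k → A (enum S r) (enum S k)) (λ k → ws l (enum S k)) ≡ 0ℚ
    restricted∈ker l r = begin
      dot (λ k → A (enum S r) (enum S k)) (λ k → ws l (enum S k))  ≡⟨ dot-spread S (A (enum S r)) _ ⟨
      dot (A (enum S r)) (spread S (λ k → ws l (enum S k)))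
        ≡⟨ dot-cong (A (enum S r)) (spread-restrict S (ws l) (proj₁ (ws∈K l))) ⟩
      dot (A (enum S r)) (ws l)                                    ≡⟨ proj₂ (ws∈K l) (enum S r) (enum-∈ S r) ⟩
      0ℚ                                                           ∎
    indep : LinIndep (λ l r → ws l (enum S r))
    indep c rel = ws-indep c rel′
      where
      rel′ : ∀ j → lin c ws j ≡ 0ℚ
      rel′ j with j ∈? S
      ... | no j∉S = sum-zero (λ l → *-by-zeroʳ (c l) (proj₁ (ws∈K l) j j∉S))
      ... | yes j∈S with enum-onto S j j∈S
      ...   | r , refl = rel r

  nullityOn⇒dim : ∀ {n} (Γ : SignedGraph n) S k → NullityOn Γ S k →
    HasIndep (SupportedKernel (adjMatrix Γ) S) k × NoIndep (SupportedKernel (adjMatrix Γ) S) (suc k)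
  nullityOn⇒dim Γ S k (large , small) =
    kernel-spread (adjMatrix Γ) S k large , kernel-restrict (adjMatrix Γ) S (suc k) small

  ¬¬-decidable : ∀ {m} (P : Fin m → Set) → ¬ ¬ (∀ w → Dec (P w))
  ¬¬-decidable {zero}  P no-decision = no-decision (λ ())
  ¬¬-decidable {suc m} P no-decision = ¬¬-excluded-middle λ P₀? →
    ¬¬-decidable (λ w → P (suc w)) λ rest? → no-decision λ { zero → P₀? ; (suc w) → rest? w }

  module Walks {n} (Γ : SignedGraph n) where

    adjacent-or-zero : ∀ i j → Adjacent Γ i j ⊎ adjMatrix Γ i j ≡ 0ℚ
    adjacent-or-zero i j with edge Γ i j
    ... | nothing = inj₂ refl
    ... | just _  = inj₁ λ ()

    adjacent-sym : ∀ {i j} → Adjacent Γ i j → Adjacent Γ j i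
    adjacent-sym {i} {j} i~j e = i~j (trans (symmetric Γ i j) e)

    walk-start : ∀ {S u w} → WalkIn Γ S u w → u ∈ S
    walk-start (here u∈S)     = u∈S
    walk-start (step u∈S _ _) = u∈S

    walk-end : ∀ {S u w} → WalkIn Γ S u w → w ∈ S
    walk-end (here w∈S)    = w∈S
    walk-end (step _ _ p) = walk-end p

    _▸_ : ∀ {S u x w} → WalkIn Γ S u x → WalkIn Γ S x w → WalkIn Γ S u w
    here _       ▸ q = q
    step u∈S a p ▸ q = step u∈S a (p ▸ q)

    walk-reverse : ∀ {S u w} → WalkIn Γ S u w → WalkIn Γ S w u
    walk-reverse (here u∈S)       = here u∈S
    walk-reverse (step u∈S u~x p) = walk-reverse p ▸ step (walk-start p) (adjacent-sym u~x) (here u∈S)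

    walk-stays : ∀ {T C C′} → C ⊆ T → IsComponentOf Γ T C′ → ∀ {u w} → WalkIn Γ C u w → u ∈ C′ → w ∈ C′
    walk-stays C⊆T C′-comp (here _)       u∈C′ = u∈C′
    walk-stays C⊆T C′-comp (step _ u~x p) u∈C′ =
      walk-stays C⊆T C′-comp p (proj₂ (proj₂ C′-comp) _ _ u∈C′ (C⊆T (walk-start p)) u~x)

    reachable-component : ∀ {T u} → u ∈ T → (reach? : ∀ w → Dec (WalkIn Γ T u w)) →
      ∃ λ R → IsComponentOf Γ T R × u ∈ R
    reachable-component {T} {u} u∈T reach? =
      R , (R⊆T , ((u , to-R (here u∈T)) , connected) , closed) , to-R (here u∈T)
      where
      R : Subset n
      R = tabulate (λ w → does (reach? w))
      to-R : ∀ {w} → WalkIn Γ T u w → w ∈ R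
      to-R {w} p with reach? w in eq
      ... | yes _ = lookup⇒[]= w R (trans (lookup∘tabulate _ w) (cong does eq))
      ... | no ¬p = ⊥-elim (¬p p)
      from-R : ∀ {w} → w ∈ R → WalkIn Γ T u w
      from-R {w} w∈R with reach? w | trans (sym (lookup∘tabulate (λ w → does (reach? w)) w)) ([]=⇒lookup w∈R)
      ... | yes p | _ = p
      ... | no  _ | ()
      R⊆T : R ⊆ T
      R⊆T w∈R = walk-end (from-R w∈R)
      inside-R : ∀ {a b} → WalkIn Γ T u a → WalkIn Γ T a b → WalkIn Γ R a b
      inside-R u⇝a (here _)         = here (to-R u⇝a)
      inside-R u⇝a (step a∈T a~x p) = step (to-R u⇝a) a~x (inside-R (u⇝a ▸ step a∈T a~x (here (walk-start p))) p)
      connected : ∀ a b → a ∈ R → b ∈ R → WalkIn Γ R a b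
      connected a b a∈R b∈R = inside-R (from-R a∈R) (walk-reverse (from-R a∈R) ▸ from-R b∈R)
      closed : ∀ a w → a ∈ R → w ∈ T → Adjacent Γ a w → w ∈ R
      closed a w a∈R w∈T a~w = to-R (from-R a∈R ▸ step (R⊆T a∈R) a~w (here w∈T))

  module Components {n} (Γ : SignedGraph n) (T : Subset n) {s} (Cs : Fin s → Subset n)
    (all-components : AllComponents Γ T Cs) where

    open Walks Γ

    component : ∀ i → IsComponentOf Γ T (Cs i)
    component = proj₁ all-components

    component⊆T : ∀ i → Cs i ⊆ T
    component⊆T i = proj₁ (component i)

    -- Two components sharing a vertex are nested, hence equal, hence equally indexed.
    nested : ∀ i i′ {j} → j ∈ Cs i → j ∈ Cs i′ → Cs i ⊆ Cs i′
    nested i i′ {j} j∈Ci j∈Ci′ w∈Ci =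
      walk-stays (component⊆T i) (component i′) (proj₂ (proj₁ (proj₂ (component i))) j _ j∈Ci w∈Ci) j∈Ci′

    disjoint : ∀ i i′ j → i ≢ i′ → j ∈ Cs i → j ∉ Cs i′
    disjoint i i′ j i≢i′ j∈Ci j∈Ci′ =
      i≢i′ (proj₁ (proj₂ all-components) i i′ (⊆-antisym (nested i i′ j∈Ci j∈Ci′) (nested i′ i j∈Ci′ j∈Ci)))

    no-edge-out : ∀ i {r j} → r ∈ Cs i → j ∈ T → j ∉ Cs i → adjMatrix Γ r j ≡ 0ℚ
    no-edge-out i {r} {j} r∈C j∈T j∉C with adjacent-or-zero r j
    ... | inj₁ r~j = ⊥-elim (j∉C (proj₂ (proj₂ (component i)) r j r∈C j∈T r~j))
    ... | inj₂ A≡0 = A≡0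

    covered : ∀ {u} → u ∈ T → ¬ ¬ (∃ λ i → u ∈ Cs i)
    covered {u} u∈T uncovered = ¬¬-decidable (WalkIn Γ T u) λ reach? →
      let (R , R-comp , u∈R) = reachable-component u∈T reach?
          (i , Ci≡R) = proj₂ (proj₂ all-components) R R-comp
      in uncovered (i , subst (u ∈_) (sym Ci≡R) u∈R)

  module CutVertex {n} (Γ : SignedGraph n) (v : Fin n) {s} (Cs : Fin s → Subset n)
    (all-components : AllComponents Γ (minusV v) Cs) where

    open Components Γ (minusV v) Cs all-components

    A : Fin n → Fin n → ℚ
    A = adjMatrix Γ
    T : Subset n
    T = minusV v
    K : Subset n → Vect n → Set
    K = SupportedKernel A

    A-sym : ∀ i j → A i j ≡ A j i
    A-sym i j = cong signValue (symmetric Γ i j)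

    ∈T : ∀ {j} → j ≢ v → j ∈ T
    ∈T j≢v = x∉p⇒x∈∁p (x≢y⇒x∉⁅y⁆ j≢v)

    v∉T : v ∉ T
    v∉T v∈T = x∈∁p⇒x∉p v∈T (x∈⁅x⁆ v)

    outside-component : ∀ i x → K T x → ∀ {r j} → r ∈ Cs i → j ∉ Cs i → A r j * x j ≡ 0ℚ
    outside-component i x (x-off , _) {r} {j} r∈C j∉C with j ≟ᶠ v
    ... | yes refl = *-by-zeroʳ (A r v) (x-off v v∉T)
    ... | no  j≢v  = *-by-zeroˡ (x j) (no-edge-out i r∈C (∈T j≢v) j∉C)

    -- K(C_i) ⊆ K(T): a row of T outside C_i does not meet C_i.
    component-kernel⊆ : ∀ i x → K (Cs i) x → K T x
    component-kernel⊆ i x (x-off , x-rows) = (λ j j∉T → x-off j (λ j∈C → j∉T (component⊆T i j∈C))) , rows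
      where
      term : ∀ {r} → r ∈ T → r ∉ Cs i → ∀ j → A r j * x j ≡ 0ℚ
      term {r} r∈T r∉C j with j ∈? Cs i
      ... | no  j∉C = *-by-zeroʳ (A r j) (x-off j j∉C)
      ... | yes j∈C = *-by-zeroˡ (x j) (trans (A-sym r j) (no-edge-out i j∈C r∈T r∉C))
      rows : ∀ r → r ∈ T → dot (A r) x ≡ 0ℚ
      rows r r∈T with r ∈? Cs i
      ... | yes r∈C = x-rows r r∈C
      ... | no  r∉C = sum-zero (term r∈T r∉C)

    restrict-to-component : ∀ i x → K T x → K (Cs i) (mask (Cs i) x)
    restrict-to-component i x x∈K = (λ j j∉C → mask-out x j∉C) , rows
      where
      same-term : ∀ {r} → r ∈ Cs i → ∀ j → A r j * mask (Cs i) x j ≡ A r j * x j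
      same-term {r} r∈C j with j ∈? Cs i
      ... | yes _   = refl
      ... | no  j∉C = trans (*-zeroʳ (A r j)) (sym (outside-component i x x∈K r∈C j∉C))
      rows : ∀ r → r ∈ Cs i → dot (A r) (mask (Cs i) x) ≡ 0ℚ
      rows r r∈C = trans (sum-cong (same-term r∈C)) (proj₂ x∈K r (component⊆T i r∈C))

    kernel-in-components : ∀ x → K T x → ∀ j → (∀ i → j ∉ Cs i) → x j ≡ 0ℚ
    kernel-in-components x (x-off , _) j uncovered with j ≟ᶠ v
    ... | yes refl = x-off v v∉T
    ... | no  j≢v with x j ≟ 0ℚ
    ...   | yes xj≡0 = xj≡0
    ...   | no  _    = ⊥-elim (covered (∈T j≢v) λ (i , j∈C) → uncovered i j∈C)

    -- η(G - v) = Σ η(G_i): K(T) is the direct sum of the K(C_i).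
    nullity-minus-cut-point : ∀ d (ds : Fin s → ℕ) → NullityOn Γ T d → (∀ i → NullityOn Γ (Cs i) (ds i)) →
      d ≡ sumℕ ds
    nullity-minus-cut-point d ds ηT ηCs = ≤-antisym
      (dim-≤ {P = K T} (proj₁ T-dim)
        (direct-sum-upper s Cs (λ i → K (Cs i)) ds (K T) (supportedKernel-closed A T)
          restrict-to-component kernel-in-components (λ i → proj₂ (C-dim i))))
      (dim-≤ {P = K T}
        (direct-sum-lower s Cs (λ i → K (Cs i)) ds (K T)
          component-kernel⊆ (λ i x → proj₁) disjoint (λ i → proj₁ (C-dim i)))
        (proj₂ T-dim))
      where
      T-dim : HasIndep (K T) d × NoIndep (K T) (suc d)
      T-dim = nullityOn⇒dim Γ T d ηT
      C-dim : ∀ i → HasIndep (K (Cs i)) (ds i) × NoIndep (K (Cs i)) (suc (ds i))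
      C-dim i = nullityOn⇒dim Γ (Cs i) (ds i) (ηCs i)

    section⊆kernel : ∀ x → Hyperplane (K T) (A v) x → InKernel A x
    section⊆kernel x ((_ , x-rows) , Ax≡0-at-v) i with i ≟ᶠ v
    ... | yes refl = Ax≡0-at-v
    ... | no  i≢v  = x-rows i (∈T i≢v)

    off-section : ∀ i b → NullityOn Γ (Cs i) (suc b) → NullityOn Γ (Cs i ∪ ⁅ v ⁆) b →
      ∃ λ z → K T z × dot (A v) z ≢ 0ℚ
    off-section i b ηC ηC+v with off-hyperplane (A v) (proj₁ (nullityOn⇒dim Γ (Cs i) (suc b) ηC))
                                   (noIndep-⊆ section⊆ (proj₂ (nullityOn⇒dim Γ (Cs i ∪ ⁅ v ⁆) b ηC+v)))
      where
      section⊆ : ∀ x → Hyperplane (K (Cs i)) (A v) x → K (Cs i ∪ ⁅ v ⁆) x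
      section⊆ x ((x-off , x-rows) , Ax≡0-at-v) =
        (λ j j∉ → x-off j (λ j∈C → j∉ (p⊆p∪q ⁅ v ⁆ j∈C))) , rows
        where
        rows : ∀ r → r ∈ Cs i ∪ ⁅ v ⁆ → dot (A r) x ≡ 0ℚ
        rows r r∈ with x∈p∪q⁻ (Cs i) ⁅ v ⁆ r∈
        ... | inj₁ r∈C = x-rows r r∈C
        ... | inj₂ r∈v with x∈⁅y⁆⇒x≡y v r∈v
        ...   | refl = Ax≡0-at-v
    ... | z , z∈K , Az≢0 = z , component-kernel⊆ i z z∈K , Az≢0

    module _ (z : Vect n) (z∈K : K T z) (Az≢0 : dot (A v) z ≢ 0ℚ) where

      -- Null vectors of A vanish at v: x_v (Az)_v = xᵀAz = zᵀAx = 0.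
      kernel-vanishes-at-v : ∀ x → InKernel A x → x v ≡ 0ℚ
      kernel-vanishes-at-v x Ax≡0 = cancel-nonzero (x v) (dot (A v) z) Az≢0 (begin
        x v * dot (A v) z                 ≡⟨ sum-single (λ j → x j * dot (A j) z) v only-v ⟨
        sumFin (λ j → x j * dot (A j) z)  ≡⟨ symmetric-pairing A A-sym x z ⟩
        sumFin (λ i → z i * dot (A i) x)  ≡⟨ sum-zero (λ i → *-by-zeroʳ (z i) (Ax≡0 i)) ⟩
        0ℚ                                ∎)
        where
        only-v : ∀ j → j ≢ v → x j * dot (A j) z ≡ 0ℚ
        only-v j j≢v = *-by-zeroʳ (x j) (proj₂ z∈K j (∈T j≢v))

      kernel⊆section : ∀ x → InKernel A x → Hyperplane (K T) (A v) x
      kernel⊆section x Ax≡0 = (support , λ i _ → Ax≡0 i) , Ax≡0 v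
        where
        support : ∀ j → j ∉ T → x j ≡ 0ℚ
        support j j∉T with j ≟ᶠ v
        ... | yes refl = kernel-vanishes-at-v x Ax≡0
        ... | no  j≢v  = ⊥-elim (j∉T (∈T j≢v))

      -- η(G) + 1 = η(G - v): the null space of A is a hyperplane section of K(T) missing z.
      nullity-drop : ∀ c d → NullityG Γ c → NullityOn Γ T d → suc c ≡ d
      nullity-drop c d ηG ηT = ≤-antisym
        (dim-≤ {P = K T} (hyperplane-lower (A v) z z∈K Az≢0 (hasIndep-⊆ kernel⊆section (proj₁ ηG)))
                         (proj₂ T-dim))
        (dim-≤ {P = K T} (proj₁ T-dim)
                         (hyperplane-upper {P = K T} (A v) (supportedKernel-closed A T)
                                           (noIndep-⊆ section⊆kernel (proj₂ ηG))))
        where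
        T-dim : HasIndep (K T) d × NoIndep (K T) (suc d)
        T-dim = nullityOn⇒dim Γ T d ηT

open import Defs
open import Data.Nat using (ℕ; suc; _+_)
open import Data.Nat.Properties using (+-comm)
open import Data.Fin using (Fin)
open import Data.Fin.Subset using (Subset; _∪_; ⁅_⁆)
open import Data.Product using (_×_; ∃; _,_)
open import Relation.Binary.PropositionalEquality using (_≡_; trans)
open SignedGraphNullity using (module CutVertex)

theorem3p1 : (n : ℕ) (Γ : SignedGraph n) → Connected Γ → (v : Fin n) → CutPoint Γ v
    → (s : ℕ) (Cs : Fin s → Subset n) → AllComponents Γ (minusV v) Cs
    → (∃ λ i → ∃ λ b → NullityOn Γ (Cs i) (suc b) × NullityOn Γ (Cs i ∪ ⁅ v ⁆) b)
    → (c d : ℕ) (ds : Fin s → ℕ)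
    → NullityG Γ c → NullityOn Γ (minusV v) d → (∀ i → NullityOn Γ (Cs i) (ds i))
    → (c + 1 ≡ d) × (d ≡ sumℕ ds)
theorem3p1 n Γ _ v _ s Cs all-components (i , b , ηGᵢ , ηGᵢ+v) c d ds ηG ηG-v ηGs =
  let open CutVertex Γ v Cs all-components
      (z , z∈K , Az≢0) = off-section i b ηGᵢ ηGᵢ+v
  in trans (+-comm c 1) (nullity-drop z z∈K Az≢0 c d ηG ηG-v) , nullity-minus-cut-point d ds ηG-v ηGs
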